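{- Let $\Lambda\subseteq\mathbb Z^n$ be a lattice generated by $d$ vectors such that the projection $\pi:\mathbb Z^n\to\mathbb Z^d$ onto the first $d$ components is injective on $\Lambda$ (i.e. the first $d$ components of vectors of $\Lambda$ are linearly independent and the remaining components are determined by them). For $v\in\Lambda$ let $\|v\|:=\|\pi(v)\|_1$. Let $\bar F\subseteq\Lambda$ be such that $\pi(\bar F)$ is the set of $\sqsubseteq$-minimal nonzero vectors of $\pi(\Lambda)$. Consider the algorithm: set $G:=\bar F$ and $C:=\{f+g: f,g\in G,\ \pi(f),\pi(g)\text{ lie in the same orthant of }\mathbb R^d\}$; while $C\ne\emptyset$: choose $s\in C$ of smallest norm $\|s\|$, remove it from $C$, compute $f:=\mathrm{nF}(s,G)$; if $f\ne 0$, add $f$ to $G$ and add to $C$ all $f+g$ with $g\in G$ such that $\pi(f),\pi(g)$ lie in the same orthant of $\mathbb R^d$. Return $G$. Then this algorithm always terminates and returns a set $G$ containing $\mathcal G(\Lambda)$.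
   Context: For $u,v\in\mathbb Z^m$, write $u\sqsubseteq v$ if $u^{(j)}v^{(j)}\ge 0$ and $|u^{(j)}|\le|v^{(j)}|$ for all $j$. The Graver basis $\mathcal G(\Lambda)$ is the set of all $\sqsubseteq$-minimal nonzero elements of $\Lambda$. Here the normal form is $\mathrm{nF}(s,G):=0$ if there is some $g\in G$ with $g\sqsubseteq s$, and $\mathrm{nF}(s,G):=s$ otherwise. -}

module Defs where

open import Data.Nat as ℕ using (ℕ; _+_)
open import Data.Integer as ℤ using (ℤ; 0ℤ; ∣_∣) renaming (_+_ to _+ℤ_; _*_ to _*ℤ_; _≤_ to _≤ℤ_; _≤?_ to _≤ℤ?_)
open import Data.Vec as Vec using (Vec; []; _∷_; zipWith; replicate; lookup)
open import Data.Vec.Relation.Unary.All as VAll using () renaming (All to VAll)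
open import Data.Fin using (Fin)
open import Data.List as List using (List; _++_; filter; map; concatMap; [_])
open import Data.List.Membership.Propositional using (_∈_)
open import Data.List.Relation.Unary.Any using (Any)
open import Data.Product using (_×_; _,_; ∃)
open import Data.Sum using (_⊎_)
open import Relation.Binary.PropositionalEquality using (_≡_; _≢_)
open import Relation.Nullary using (¬_; Dec)
open import Relation.Binary.Construct.Closure.ReflexiveTransitive using (Star)

Zvec : ℕ → Set
Zvec m = Vec ℤ m

0v : ∀ {m} → Zvec m
0v = replicate _ 0ℤ

_⊕_ : ∀ {m} → Zvec m → Zvec m → Zvec m
_⊕_ = zipWith _+ℤ_

_·_ : ∀ {m} → ℤ → Zvec m → Zvec m
c · v = Vec.map (c *ℤ_) v

lincomb : ∀ {d m} → Vec ℤ d → Vec (Zvec m) d → Zvec m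
lincomb [] [] = 0v
lincomb (c ∷ cs) (b ∷ bs) = (c · b) ⊕ lincomb cs bs

InLattice : ∀ {d m} → Vec (Zvec m) d → Zvec m → Set
InLattice {d} B v = ∃ λ (c : Vec ℤ d) → lincomb c B ≡ v

_⊑_ : ∀ {m} → Zvec m → Zvec m → Set
u ⊑ v = ∀ j → (0ℤ ≤ℤ lookup u j *ℤ lookup v j) × (∣ lookup u j ∣ ℕ.≤ ∣ lookup v j ∣)

MinimalNonzero : ∀ {m} → (Zvec m → Set) → Zvec m → Set
MinimalNonzero L g = L g × g ≢ 0v × (∀ h → L h → h ≢ 0v → h ⊑ g → h ≡ g)

InGraver : ∀ {d m} → Vec (Zvec m) d → Zvec m → Set
InGraver B = MinimalNonzero (InLattice B)

π : ∀ d {k} → Zvec (d + k) → Zvec d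
π d v = Vec.take d v

InProjLattice : ∀ {d k} → Vec (Zvec (d + k)) d → Zvec d → Set
InProjLattice {d} B w = ∃ λ v → InLattice B v × π d v ≡ w

norm1 : ∀ {m} → Zvec m → ℕ
norm1 v = Vec.sum (Vec.map ∣_∣ v)

norm : ∀ d {k} → Zvec (d + k) → ℕ
norm d v = norm1 (π d v)

SameOrthant : ∀ {m} → Zvec m → Zvec m → Set
SameOrthant u v = VAll (0ℤ ≤ℤ_) (zipWith _*ℤ_ u v)

sameOrthant? : ∀ {m} (u v : Zvec m) → Dec (SameOrthant u v)
sameOrthant? u v = VAll.all? (0ℤ ≤ℤ?_) (zipWith _*ℤ_ u v)

newPairs : ∀ d {k} → Zvec (d + k) → List (Zvec (d + k)) → List (Zvec (d + k))
newPairs d f G = map (f ⊕_) (filter (λ g → sameOrthant? (π d f) (π d g)) G)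

initPairs : ∀ d {k} → List (Zvec (d + k)) → List (Zvec (d + k))
initPairs d G = concatMap (λ f → newPairs d f G) G

NF : ∀ {m} → Zvec m → List (Zvec m) → Zvec m → Set
NF s G f = (Any (_⊑ s) G × f ≡ 0v) ⊎ ((¬ Any (_⊑ s) G) × f ≡ s)

State : ℕ → Set
State m = List (Zvec m) × List (Zvec m)

-- one iteration of the while loop (nondeterministic choice of a norm-minimal s ∈ C)
data Step (d k : ℕ) : State (d + k) → State (d + k) → Set where
  stepZero : ∀ {G C₁ C₂ s f}
    → (∀ t → t ∈ (C₁ ++ s List.∷ C₂) → norm d s ℕ.≤ norm d t)
    → NF s G f → f ≡ 0v
    → Step d k (G , C₁ ++ s List.∷ C₂) (G , C₁ ++ C₂)
  stepAdd : ∀ {G C₁ C₂ s f}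
    → (∀ t → t ∈ (C₁ ++ s List.∷ C₂) → norm d s ℕ.≤ norm d t)
    → NF s G f → f ≢ 0v
    → Step d k (G , C₁ ++ s List.∷ C₂)
               (G ++ [ f ] , (C₁ ++ C₂) ++ newPairs d f (G ++ [ f ]))

Reachable : ∀ d k → State (d + k) → State (d + k) → Set
Reachable d k = Star (Step d k)

-- A step either shrinks C or adds to G the chosen s, whose normal form is s itself:
-- no element already in G is ⊑ s. Recording the positive and negative parts of a vector turns ⊑
-- into the coordinatewise order on ℕ^(2n), so by Dickson's lemma only finitely many vectors are
-- ever added, and between two additions C shrinks.
--
-- Invariantly, whenever x, y ∈ G and π x, π y lie in a common orthant, x + y is
-- still in C, is 0, or lies ⊒ some element of G. Once C is empty, every v ∈ Λ is a sum of elements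
-- of G that are all ⊑ v, by induction on ‖π v‖₁ (positive for v ≠ 0 as π is injective on Λ):
-- take f ∈ F̄ with π f ⊑ π v (below a ⊑-minimal element of π Λ), decompose v − f, and, while two
-- summands a, b are not sign-compatible, replace them by some h ⊑ a + b in G together with a
-- decomposition of a + b − h, whose projected norm is smaller. Each replacement lowers the sum of
-- the ℓ₁-norms of the summands. A Graver element then equals one of its summands.
--
-- The classical steps (minimal elements, Dickson's lemma) run in the double-negation monad,
-- which suffices because the goals ⊥ and g ∈ G are stable.

module Submission where

open import Defs
open import Data.Nat using (ℕ; _+_; suc)
open import Data.Vec using (Vec)
open import Data.List using (List; []; map)
open import Data.List.Membership.Propositional using (_∈_)
open import Data.Product using (_×_; _,_)
open import Relation.Binary.PropositionalEquality using (_≡_)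
open import Relation.Nullary using (¬_)

open import Level using (0ℓ)
open import Function using (_∘_)
open import Data.Empty using (⊥)
open import Data.Unit using (⊤; tt)
open import Data.Product using (proj₁; proj₂; ∃; ∃₂)
open import Data.Sum as Sum using (_⊎_; inj₁; inj₂)
open import Data.Nat.Base as ℕ using (zero; _≤_; _<_; z≤n; s≤s; _⊔_)
import Data.Nat.Properties as ℕₚ
import Data.Nat.Induction as ℕᵢ
open import Data.Nat.ListAction using (sum)
import Data.Nat.ListAction.Properties as sumₚ
open import Algebra.Properties.CommutativeSemigroup ℕₚ.+-commutativeSemigroup
  using () renaming (interchange to +-interchange)
open import Data.Integer.Base as ℤ using (ℤ; +_; -[1+_]; +0; +[1+_]; 0ℤ; ∣_∣; _◃_)
import Data.Integer.Properties as ℤₚ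
open import Data.Integer.Tactic.RingSolver using (solve-∀)
import Data.Sign.Base as Sign
import Data.Fin.Base as Fin
open import Data.Vec.Base as Vec using ([]; _∷_; zipWith)
import Data.Vec.Properties as Vecₚ
open import Data.Vec.Relation.Unary.All as VAll using () renaming (All to VAll)
open import Data.Vec.Relation.Binary.Pointwise.Inductive as Pw using (Pointwise; []; _∷_)
import Data.List.Base as List
open import Data.List.Base using (_∷_; _++_; [_])
import Data.List.Properties as Listₚ
open import Data.List.Relation.Unary.All as All using (All; []; _∷_; all?)
import Data.List.Relation.Unary.All.Properties as Allₚ
open import Data.List.Relation.Unary.Any using (Any; here; there)
open import Data.List.Membership.Propositional using (find; lose)
open import Data.List.Membership.Propositional.Properties
  using (∈-map⁺; ∈-map⁻; ∈-++⁺ˡ; ∈-++⁺ʳ; ∈-++⁻; ∈-filter⁺; ∈-filter⁻; ∈-concatMap⁺; ∈-concatMap⁻; ∈-∃++)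
import Data.List.Membership.DecPropositional as DecMem
open import Data.List.Relation.Binary.Permutation.Propositional as ↭ using (_↭_)
import Data.List.Relation.Binary.Permutation.Propositional.Properties as ↭ₚ
open import Relation.Binary.Definitions using (Decidable; DecidableEquality)
open import Relation.Binary.PropositionalEquality
  using (_≢_; refl; sym; trans; cong; cong₂; subst; subst₂; module ≡-Reasoning)
open import Relation.Binary.Construct.Closure.ReflexiveTransitive using (ε; _◅_)
open import Relation.Nullary using (Dec; yes; no; contradiction)
open import Relation.Nullary.Decidable using (_×-dec_; ¬¬-excluded-middle; decidable-stable)
open import Relation.Nullary.Negation using (¬¬-Monad)
open import Effect.Monad using (RawMonad)
open import Induction.WellFounded using (Acc; acc)

infix 4 _≍_ _≼_ _≍?_

-- x ≍ y means 0 ≤ x * y, stated by cases (≍⇒0≤x*y, 0≤x*y⇒≍); ⊑ and SameOrthant of Defs are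
-- the coordinatewise ≼ and ≍.
data _≍_ : ℤ → ℤ → Set where
  +≍+ : ∀ {m n} → + m ≍ + n
  -≍- : ∀ {m n} → -[1+ m ] ≍ -[1+ n ]
  0≍- : ∀ {n} → +0 ≍ -[1+ n ]
  -≍0 : ∀ {m} → -[1+ m ] ≍ +0

_≼_ : ℤ → ℤ → Set
x ≼ y = x ≍ y × ∣ x ∣ ≤ ∣ y ∣

0≍ : ∀ x → +0 ≍ x
0≍ (+ _)    = +≍+
0≍ -[1+ _ ] = 0≍-

≍-refl : ∀ x → x ≍ x
≍-refl (+ _)    = +≍+
≍-refl -[1+ _ ] = -≍-

≍-sym : ∀ {x y} → x ≍ y → y ≍ x
≍-sym +≍+ = +≍+
≍-sym -≍- = -≍-
≍-sym 0≍- = -≍0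
≍-sym -≍0 = 0≍-

≍-+ : ∀ {x y z} → x ≍ y → x ≍ z → x ≍ y ℤ.+ z
≍-+ {+0}       _   _   = 0≍ _
≍-+ {+[1+ _ ]} +≍+ +≍+ = +≍+
≍-+ -≍- -≍- = -≍-
≍-+ -≍- -≍0 = -≍-
≍-+ -≍0 -≍- = -≍-
≍-+ -≍0 -≍0 = -≍0

_≍?_ : Decidable _≍_
+ _      ≍? + _      = yes +≍+
+0       ≍? -[1+ _ ] = yes 0≍-
+[1+ _ ] ≍? -[1+ _ ] = no λ ()
-[1+ _ ] ≍? +0       = yes -≍0
-[1+ _ ] ≍? +[1+ _ ] = no λ ()
-[1+ _ ] ≍? -[1+ _ ] = yes -≍-

≍⇒∣x+y∣≡∣x∣+∣y∣ : ∀ {x y} → x ≍ y → ∣ x ℤ.+ y ∣ ≡ ∣ x ∣ + ∣ y ∣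
≍⇒∣x+y∣≡∣x∣+∣y∣ +≍+ = refl
≍⇒∣x+y∣≡∣x∣+∣y∣ (-≍- {m} {n}) = cong suc (sym (ℕₚ.+-suc m n))
≍⇒∣x+y∣≡∣x∣+∣y∣ 0≍- = refl
≍⇒∣x+y∣≡∣x∣+∣y∣ -≍0 = sym (ℕₚ.+-identityʳ _)

∣[1+m]⊖[1+n]∣<[1+m]+[1+n] : ∀ m n → ∣ suc m ℤ.⊖ suc n ∣ < suc m + suc n
∣[1+m]⊖[1+n]∣<[1+m]+[1+n] m n = begin-strict
  ∣ suc m ℤ.⊖ suc n ∣ ≤⟨ ℤₚ.∣m⊝n∣≤m⊔n (suc m) (suc n) ⟩
  suc (m ⊔ n)       ≤⟨ s≤s (ℕₚ.m⊔n≤m+n m n) ⟩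
  suc (m + n)       <⟨ s≤s (ℕₚ.+-monoʳ-< m (ℕₚ.n<1+n n)) ⟩
  suc (m + suc n)   ∎
  where open ℕₚ.≤-Reasoning

≭⇒∣x+y∣<∣x∣+∣y∣ : ∀ {x y} → ¬ x ≍ y → ∣ x ℤ.+ y ∣ < ∣ x ∣ + ∣ y ∣
≭⇒∣x+y∣<∣x∣+∣y∣ {+ _}      {+ _}      x≭y = contradiction +≍+ x≭y
≭⇒∣x+y∣<∣x∣+∣y∣ {+0}       { -[1+ _ ]} x≭y = contradiction 0≍- x≭y
≭⇒∣x+y∣<∣x∣+∣y∣ {+[1+ m ]} { -[1+ n ]} _   = ∣[1+m]⊖[1+n]∣<[1+m]+[1+n] m n
≭⇒∣x+y∣<∣x∣+∣y∣ { -[1+ _ ]} {+0}       x≭y = contradiction -≍0 x≭y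
≭⇒∣x+y∣<∣x∣+∣y∣ { -[1+ m ]} {+[1+ n ]} _   =
  subst (∣ suc n ℤ.⊖ suc m ∣ <_) (ℕₚ.+-comm (suc n) (suc m)) (∣[1+m]⊖[1+n]∣<[1+m]+[1+n] n m)
≭⇒∣x+y∣<∣x∣+∣y∣ { -[1+ _ ]} { -[1+ _ ]} x≭y = contradiction -≍- x≭y

≼-refl : ∀ x → x ≼ x
≼-refl x = ≍-refl x , ℕₚ.≤-refl

≼-≍-trans : ∀ {x y z} → x ≼ y → y ≍ z → x ≍ z
≼-≍-trans (+≍+ {zero}  , _)  _   = 0≍ _
≼-≍-trans (+≍+ {suc _} , _)  +≍+ = +≍+
≼-≍-trans (+≍+ {suc _} , ()) 0≍-
≼-≍-trans (-≍-         , _)  -≍- = -≍-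
≼-≍-trans (-≍-         , _)  -≍0 = -≍0
≼-≍-trans (0≍-         , _)  _   = 0≍ _
≼-≍-trans (-≍0         , ()) _

≼-trans : ∀ {x y z} → x ≼ y → y ≼ z → x ≼ z
≼-trans x≼y (y≍z , ∣y∣≤∣z∣) = ≼-≍-trans x≼y y≍z , ℕₚ.≤-trans (proj₂ x≼y) ∣y∣≤∣z∣

≍⇒x≼x+y : ∀ {x y} → x ≍ y → x ≼ x ℤ.+ y
≍⇒x≼x+y {x} {y} x≍y =
  ≍-+ (≍-refl x) x≍y , subst (∣ x ∣ ≤_) (sym (≍⇒∣x+y∣≡∣x∣+∣y∣ x≍y)) (ℕₚ.m≤m+n ∣ x ∣ ∣ y ∣)

-≍neg : ∀ m n → -[1+ m ] ≍ ℤ.- (+ n)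
-≍neg _ zero    = -≍0
-≍neg _ (suc _) = -≍-

x≼y⇒x≍y-x : ∀ {x y} → x ≼ y → x ≍ y ℤ.- x
x≼y⇒x≍y-x (+≍+ {zero} , _) = 0≍ _
x≼y⇒x≍y-x (+≍+ {suc _} , m≤n) rewrite ℤₚ.⊖-≥ m≤n = +≍+
x≼y⇒x≍y-x (-≍- {m} {n} , s≤s m≤n)
  rewrite ℤₚ.[1+m]⊖[1+n]≡m⊖n m n | ℤₚ.⊖-≤ m≤n = -≍neg m (n ℕ.∸ m)
x≼y⇒x≍y-x (0≍- , _) = 0≍ _
x≼y⇒x≍y-x (-≍0 , ())

x≼y∧∣x∣≡∣y∣⇒x≡y : ∀ {x y} → x ≼ y → ∣ x ∣ ≡ ∣ y ∣ → x ≡ y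
x≼y∧∣x∣≡∣y∣⇒x≡y (+≍+ , _) ∣x∣≡∣y∣ = cong +_ ∣x∣≡∣y∣
x≼y∧∣x∣≡∣y∣⇒x≡y (-≍- , _) ∣x∣≡∣y∣ = cong -[1+_] (ℕₚ.suc-injective ∣x∣≡∣y∣)
x≼y∧∣x∣≡∣y∣⇒x≡y (0≍- , _) ()
x≼y∧∣x∣≡∣y∣⇒x≡y (-≍0 , ()) _

_≼?_ : Decidable _≼_
x ≼? y = (x ≍? y) ×-dec (∣ x ∣ ℕₚ.≤? ∣ y ∣)

0≤+◃ : ∀ n → 0ℤ ℤ.≤ Sign.+ ◃ n
0≤+◃ zero    = ℤ.+≤+ z≤n
0≤+◃ (suc _) = ℤ.+≤+ z≤n

≍⇒0≤x*y : ∀ {x y} → x ≍ y → 0ℤ ℤ.≤ x ℤ.* y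
≍⇒0≤x*y (+≍+ {m} {n}) = 0≤+◃ (m ℕ.* n)
≍⇒0≤x*y -≍-           = ℤ.+≤+ z≤n
≍⇒0≤x*y 0≍-           = ℤ.+≤+ z≤n
≍⇒0≤x*y (-≍0 {m})     = ℤₚ.≤-reflexive (sym (ℤₚ.*-zeroʳ -[1+ m ]))

0≤x*y⇒≍ : ∀ x y → 0ℤ ℤ.≤ x ℤ.* y → x ≍ y
0≤x*y⇒≍ (+ _)      (+ _)      _  = +≍+
0≤x*y⇒≍ +0         -[1+ _ ]   _  = 0≍-
0≤x*y⇒≍ +[1+ _ ]   -[1+ _ ]   ()
0≤x*y⇒≍ -[1+ _ ]   +0         _  = -≍0
0≤x*y⇒≍ -[1+ _ ]   +[1+ _ ]   ()
0≤x*y⇒≍ -[1+ _ ]   -[1+ _ ]   _  = -≍-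

-- The conformal order on integer vectors

infix 4 _≍ᵛ_ _≼ᵛ_ _≍ᵛ?_ _≼ᵛ?_ _≟ᵛ_
infixl 6 _⊖_

_≍ᵛ_ _≼ᵛ_ : ∀ {m} → Zvec m → Zvec m → Set
_≍ᵛ_ = Pointwise _≍_
_≼ᵛ_ = Pointwise _≼_

_≼ᵛ?_ : ∀ {m} → Decidable (_≼ᵛ_ {m})
_≼ᵛ?_ = Pw.decidable _≼?_

_≍ᵛ?_ : ∀ {m} → Decidable (_≍ᵛ_ {m})
_≍ᵛ?_ = Pw.decidable _≍?_

_≟ᵛ_ : ∀ {m} → DecidableEquality (Zvec m)
_≟ᵛ_ = Vecₚ.≡-dec ℤₚ._≟_

_⊖_ : ∀ {m} → Zvec m → Zvec m → Zvec m
_⊖_ = zipWith ℤ._-_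

⊑⇒≼ᵛ : ∀ {m} {u v : Zvec m} → u ⊑ v → u ≼ᵛ v
⊑⇒≼ᵛ {u = []}    {[]}    _   = []
⊑⇒≼ᵛ {u = x ∷ _} {y ∷ _} u⊑v =
  (0≤x*y⇒≍ x y (proj₁ (u⊑v Fin.zero)) , proj₂ (u⊑v Fin.zero)) ∷ ⊑⇒≼ᵛ (u⊑v ∘ Fin.suc)

≼ᵛ⇒⊑ : ∀ {m} {u v : Zvec m} → u ≼ᵛ v → u ⊑ v
≼ᵛ⇒⊑ ((x≍y , ∣x∣≤∣y∣) ∷ _) Fin.zero    = ≍⇒0≤x*y x≍y , ∣x∣≤∣y∣
≼ᵛ⇒⊑ (_ ∷ u≼v)             (Fin.suc j) = ≼ᵛ⇒⊑ u≼v j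

≍ᵛ⇒SameOrthant : ∀ {m} {u v : Zvec m} → u ≍ᵛ v → SameOrthant u v
≍ᵛ⇒SameOrthant []            = VAll.[]
≍ᵛ⇒SameOrthant (x≍y ∷ u≍v) = ≍⇒0≤x*y x≍y VAll.∷ ≍ᵛ⇒SameOrthant u≍v

SameOrthant-sym : ∀ {m} {u v : Zvec m} → SameOrthant u v → SameOrthant v u
SameOrthant-sym {u = u} {v} = subst (VAll (0ℤ ℤ.≤_)) (Vecₚ.zipWith-comm ℤₚ.*-comm u v)

≼ᵛ-refl : ∀ {m} {u : Zvec m} → u ≼ᵛ u
≼ᵛ-refl = Pw.refl (≼-refl _)

≼ᵛ-trans : ∀ {m} {u v w : Zvec m} → u ≼ᵛ v → v ≼ᵛ w → u ≼ᵛ w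
≼ᵛ-trans = Pw.trans ≼-trans

≍ᵛ-sym : ∀ {m} {u v : Zvec m} → u ≍ᵛ v → v ≍ᵛ u
≍ᵛ-sym = Pw.sym ≍-sym

≍ᵛ-0v : ∀ {m} (u : Zvec m) → u ≍ᵛ 0v
≍ᵛ-0v []      = []
≍ᵛ-0v (x ∷ u) = ≍-sym (0≍ x) ∷ ≍ᵛ-0v u

≍ᵛ-⊕ : ∀ {m} {u v w : Zvec m} → u ≍ᵛ v → u ≍ᵛ w → u ≍ᵛ v ⊕ w
≍ᵛ-⊕ []          []          = []
≍ᵛ-⊕ (x≍y ∷ u≍v) (x≍z ∷ u≍w) = ≍-+ x≍y x≍z ∷ ≍ᵛ-⊕ u≍v u≍w

≍ᵛ⇒u≼ᵛu⊕v : ∀ {m} {u v : Zvec m} → u ≍ᵛ v → u ≼ᵛ u ⊕ v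
≍ᵛ⇒u≼ᵛu⊕v []          = []
≍ᵛ⇒u≼ᵛu⊕v (x≍y ∷ u≍v) = ≍⇒x≼x+y x≍y ∷ ≍ᵛ⇒u≼ᵛu⊕v u≍v

≼ᵛ-≍ᵛ-trans : ∀ {m} {u v w : Zvec m} → u ≼ᵛ v → v ≍ᵛ w → u ≍ᵛ w
≼ᵛ-≍ᵛ-trans = Pw.trans ≼-≍-trans

≼ᵛ-upperBound⇒≍ᵛ : ∀ {m} {u v s : Zvec m} → u ≼ᵛ s → v ≼ᵛ s → u ≍ᵛ v
≼ᵛ-upperBound⇒≍ᵛ u≼s v≼s = ≼ᵛ-≍ᵛ-trans u≼s (≍ᵛ-sym (Pw.map proj₁ v≼s))

u≼ᵛv⇒u≍ᵛv⊖u : ∀ {m} {u v : Zvec m} → u ≼ᵛ v → u ≍ᵛ v ⊖ u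
u≼ᵛv⇒u≍ᵛv⊖u []          = []
u≼ᵛv⇒u≍ᵛv⊖u (x≼y ∷ u≼v) = x≼y⇒x≍y-x x≼y ∷ u≼ᵛv⇒u≍ᵛv⊖u u≼v

⊕-comm : ∀ {m} (u v : Zvec m) → u ⊕ v ≡ v ⊕ u
⊕-comm = Vecₚ.zipWith-comm ℤₚ.+-comm

⊕-assoc : ∀ {m} (u v w : Zvec m) → (u ⊕ v) ⊕ w ≡ u ⊕ (v ⊕ w)
⊕-assoc = Vecₚ.zipWith-assoc ℤₚ.+-assoc

⊕-identityˡ : ∀ {m} (u : Zvec m) → 0v ⊕ u ≡ u
⊕-identityˡ = Vecₚ.zipWith-identityˡ ℤₚ.+-identityˡ

u⊕[v⊖u]≡v : ∀ {m} (u v : Zvec m) → u ⊕ (v ⊖ u) ≡ v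
u⊕[v⊖u]≡v []      []      = refl
u⊕[v⊖u]≡v (x ∷ u) (y ∷ v) = cong₂ _∷_ (x+[y-x]≡y x y) (u⊕[v⊖u]≡v u v)
  where
  x+[y-x]≡y : ∀ x y → x ℤ.+ (y ℤ.- x) ≡ y
  x+[y-x]≡y = solve-∀

v⊖u≼ᵛv : ∀ {m} {u v : Zvec m} → u ≼ᵛ v → v ⊖ u ≼ᵛ v
v⊖u≼ᵛv {u = u} {v} u≼v = subst (v ⊖ u ≼ᵛ_) (trans (⊕-comm (v ⊖ u) u) (u⊕[v⊖u]≡v u v))
  (≍ᵛ⇒u≼ᵛu⊕v (≍ᵛ-sym (u≼ᵛv⇒u≍ᵛv⊖u u≼v)))

norm1-0v : ∀ {m} → norm1 (0v {m}) ≡ 0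
norm1-0v {zero}  = refl
norm1-0v {suc m} = norm1-0v {m}

norm1≡0⇒≡0v : ∀ {m} (u : Zvec m) → norm1 u ≡ 0 → u ≡ 0v
norm1≡0⇒≡0v []      _  = refl
norm1≡0⇒≡0v (x ∷ u) eq =
  cong₂ _∷_ (ℤₚ.∣i∣≡0⇒i≡0 (ℕₚ.m+n≡0⇒m≡0 ∣ x ∣ eq)) (norm1≡0⇒≡0v u (ℕₚ.m+n≡0⇒n≡0 ∣ x ∣ eq))

u≢0v⇒norm1>0 : ∀ {m} {u : Zvec m} → u ≢ 0v → 0 < norm1 u
u≢0v⇒norm1>0 {u = u} u≢0 = ℕₚ.n≢0⇒n>0 (u≢0 ∘ norm1≡0⇒≡0v u)

norm1-⊕-≤ : ∀ {m} (u v : Zvec m) → norm1 (u ⊕ v) ≤ norm1 u + norm1 v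
norm1-⊕-≤ []      []      = z≤n
norm1-⊕-≤ (x ∷ u) (y ∷ v) = ℕₚ.≤-trans
  (ℕₚ.+-mono-≤ (ℤₚ.∣i+j∣≤∣i∣+∣j∣ x y) (norm1-⊕-≤ u v))
  (ℕₚ.≤-reflexive (+-interchange ∣ x ∣ ∣ y ∣ (norm1 u) (norm1 v)))

norm1-⊕-≍ᵛ : ∀ {m} {u v : Zvec m} → u ≍ᵛ v → norm1 (u ⊕ v) ≡ norm1 u + norm1 v
norm1-⊕-≍ᵛ [] = refl
norm1-⊕-≍ᵛ {u = x ∷ u} {y ∷ v} (x≍y ∷ u≍v) = trans
  (cong₂ _+_ (≍⇒∣x+y∣≡∣x∣+∣y∣ x≍y) (norm1-⊕-≍ᵛ u≍v))
  (+-interchange ∣ x ∣ ∣ y ∣ (norm1 u) (norm1 v))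

norm1-⊕-≭ᵛ : ∀ {m} (u v : Zvec m) → ¬ u ≍ᵛ v → norm1 (u ⊕ v) < norm1 u + norm1 v
norm1-⊕-≭ᵛ []      []      u≭v = contradiction [] u≭v
norm1-⊕-≭ᵛ (x ∷ u) (y ∷ v) x∷u≭y∷v =
  ℕₚ.<-≤-trans (heads-or-tails (x ≍? y))
               (ℕₚ.≤-reflexive (+-interchange ∣ x ∣ ∣ y ∣ (norm1 u) (norm1 v)))
  where
  heads-or-tails : Dec (x ≍ y) → ∣ x ℤ.+ y ∣ + norm1 (u ⊕ v) < (∣ x ∣ + ∣ y ∣) + (norm1 u + norm1 v)
  heads-or-tails (yes x≍y) = ℕₚ.+-mono-≤-< (ℤₚ.∣i+j∣≤∣i∣+∣j∣ x y)
                                            (norm1-⊕-≭ᵛ u v (x∷u≭y∷v ∘ (x≍y ∷_)))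
  heads-or-tails (no x≭y)  = ℕₚ.+-mono-<-≤ (≭⇒∣x+y∣<∣x∣+∣y∣ x≭y) (norm1-⊕-≤ u v)

norm1-⊖ : ∀ {m} {u v : Zvec m} → u ≼ᵛ v → norm1 u + norm1 (v ⊖ u) ≡ norm1 v
norm1-⊖ {u = u} {v} u≼v = trans (sym (norm1-⊕-≍ᵛ (u≼ᵛv⇒u≍ᵛv⊖u u≼v))) (cong norm1 (u⊕[v⊖u]≡v u v))

norm1-mono-≼ᵛ : ∀ {m} {u v : Zvec m} → u ≼ᵛ v → norm1 u ≤ norm1 v
norm1-mono-≼ᵛ []                     = z≤n
norm1-mono-≼ᵛ ((_ , ∣x∣≤∣y∣) ∷ u≼v) = ℕₚ.+-mono-≤ ∣x∣≤∣y∣ (norm1-mono-≼ᵛ u≼v)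

norm1-strictMono-≼ᵛ : ∀ {m} {u v : Zvec m} → u ≼ᵛ v → u ≢ v → norm1 u < norm1 v
norm1-strictMono-≼ᵛ []                 u≢v = contradiction refl u≢v
norm1-strictMono-≼ᵛ (x≼y ∷ u≼v) x∷u≢y∷v with ℕₚ.m≤n⇒m<n∨m≡n (proj₂ x≼y)
... | inj₁ ∣x∣<∣y∣ = ℕₚ.+-mono-<-≤ ∣x∣<∣y∣ (norm1-mono-≼ᵛ u≼v)
... | inj₂ ∣x∣≡∣y∣ = ℕₚ.+-mono-≤-< (proj₂ x≼y)
  (norm1-strictMono-≼ᵛ u≼v (x∷u≢y∷v ∘ cong₂ _∷_ (x≼y∧∣x∣≡∣y∣⇒x≡y x≼y ∣x∣≡∣y∣)))

π-⊕ : ∀ d {k} (u v : Zvec (d + k)) → π d (u ⊕ v) ≡ π d u ⊕ π d v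
π-⊕ d = Vecₚ.take-zipWith {m = d} ℤ._+_

π-⊖ : ∀ d {k} (u v : Zvec (d + k)) → π d (u ⊖ v) ≡ π d u ⊖ π d v
π-⊖ d = Vecₚ.take-zipWith {m = d} ℤ._-_

π-0v : ∀ d {k} → π d {k} 0v ≡ 0v
π-0v zero    = refl
π-0v (suc d) = cong (0ℤ ∷_) (π-0v d)

π-Pointwise : ∀ d {k} {R : ℤ → ℤ → Set} {u v : Zvec (d + k)} → Pointwise R u v → Pointwise R (π d u) (π d v)
π-Pointwise zero    _          = []
π-Pointwise (suc d) (r ∷ u∼v) = r ∷ π-Pointwise d u∼v

lincomb-0 : ∀ {d m} (B : Vec (Zvec m) d) → lincomb (Vec.replicate d 0ℤ) B ≡ 0v
lincomb-0 []      = refl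
lincomb-0 (b ∷ B) = trans (cong₂ _⊕_ (Vecₚ.map-const b 0ℤ) (lincomb-0 B)) (⊕-identityˡ 0v)

module _ (_∙_ : ℤ → ℤ → ℤ)
         (∙-distrib-* : ∀ a b x → (a ∙ b) ℤ.* x ≡ (a ℤ.* x) ∙ (b ℤ.* x))
         (∙-interchange-+ : ∀ p q r s → (p ∙ q) ℤ.+ (r ∙ s) ≡ (p ℤ.+ r) ∙ (q ℤ.+ s))
         (0∙0 : 0ℤ ∙ 0ℤ ≡ 0ℤ)
         where

  private
    ·-zipWith : ∀ {m} a b (v : Zvec m) → (a ∙ b) · v ≡ zipWith _∙_ (a · v) (b · v)
    ·-zipWith a b []      = refl
    ·-zipWith a b (x ∷ v) = cong₂ _∷_ (∙-distrib-* a b x) (·-zipWith a b v)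

    ⊕-zipWith : ∀ {m} (p q r s : Zvec m) →
                zipWith _∙_ p q ⊕ zipWith _∙_ r s ≡ zipWith _∙_ (p ⊕ r) (q ⊕ s)
    ⊕-zipWith []      []      []      []      = refl
    ⊕-zipWith (p ∷ ps) (q ∷ qs) (r ∷ rs) (s ∷ ss) =
      cong₂ _∷_ (∙-interchange-+ p q r s) (⊕-zipWith ps qs rs ss)

  lincomb-zipWith : ∀ {d m} (c c′ : Vec ℤ d) (B : Vec (Zvec m) d) →
                    lincomb (zipWith _∙_ c c′) B ≡ zipWith _∙_ (lincomb c B) (lincomb c′ B)
  lincomb-zipWith [] [] [] =
    sym (trans (Vecₚ.zipWith-replicate _∙_ 0ℤ 0ℤ) (cong (Vec.replicate _) 0∙0))
  lincomb-zipWith (a ∷ c) (a′ ∷ c′) (b ∷ B) = trans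
    (cong₂ _⊕_ (·-zipWith a a′ b) (lincomb-zipWith c c′ B))
    (⊕-zipWith (a · b) (a′ · b) (lincomb c B) (lincomb c′ B))

module _ {d m} (B : Vec (Zvec m) d) where

  InLattice-0v : InLattice B 0v
  InLattice-0v = Vec.replicate d 0ℤ , lincomb-0 B

  InLattice-⊕ : ∀ {u v} → InLattice B u → InLattice B v → InLattice B (u ⊕ v)
  InLattice-⊕ (c , refl) (c′ , refl) = zipWith ℤ._+_ c c′ , lincomb-zipWith ℤ._+_ solve-∀ solve-∀ refl c c′ B

  InLattice-⊖ : ∀ {u v} → InLattice B u → InLattice B v → InLattice B (u ⊖ v)
  InLattice-⊖ (c , refl) (c′ , refl) = zipWith ℤ._-_ c c′ , lincomb-zipWith ℤ._-_ solve-∀ solve-∀ refl c c′ B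

π-nonzero : ∀ {d k} {B : Vec (Zvec (d + k)) d} →
            (∀ u v → InLattice B u → InLattice B v → π d u ≡ π d v → u ≡ v) →
            ∀ {v} → InLattice B v → v ≢ 0v → π d v ≢ 0v
π-nonzero {d} {B = B} π-injective v∈Λ v≢0 πv≡0 =
  v≢0 (π-injective _ 0v v∈Λ (InLattice-0v B) (trans πv≡0 (sym (π-0v d))))

∑ : ∀ {m} → List (Zvec m) → Zvec m
∑ = List.foldr _⊕_ 0v

totalNorm : ∀ {m} → List (Zvec m) → ℕ
totalNorm = sum ∘ map norm1

⊕-left-comm : ∀ {m} (u v w : Zvec m) → u ⊕ (v ⊕ w) ≡ v ⊕ (u ⊕ w)
⊕-left-comm u v w = begin
  u ⊕ (v ⊕ w)   ≡⟨ sym (⊕-assoc u v w) ⟩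
  (u ⊕ v) ⊕ w   ≡⟨ cong (_⊕ w) (⊕-comm u v) ⟩
  (v ⊕ u) ⊕ w   ≡⟨ ⊕-assoc v u w ⟩
  v ⊕ (u ⊕ w)   ∎
  where open ≡-Reasoning

∑-++ : ∀ {m} (xs ys : List (Zvec m)) → ∑ (xs ++ ys) ≡ ∑ xs ⊕ ∑ ys
∑-++ []       ys = sym (⊕-identityˡ (∑ ys))
∑-++ (x ∷ xs) ys = trans (cong (x ⊕_) (∑-++ xs ys)) (sym (⊕-assoc x (∑ xs) (∑ ys)))

∑-↭ : ∀ {m} {xs ys : List (Zvec m)} → xs ↭ ys → ∑ xs ≡ ∑ ys
∑-↭ ↭.refl         = refl
∑-↭ (↭.prep x p)   = cong (x ⊕_) (∑-↭ p)
∑-↭ (↭.swap x y p) = trans (cong (λ s → x ⊕ (y ⊕ s)) (∑-↭ p)) (⊕-left-comm x y _)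
∑-↭ (↭.trans p q)  = trans (∑-↭ p) (∑-↭ q)

π-∑ : ∀ d {k} (xs : List (Zvec (d + k))) → π d (∑ xs) ≡ ∑ (map (π d) xs)
π-∑ d []       = π-0v d
π-∑ d (x ∷ xs) = trans (π-⊕ d x (∑ xs)) (cong (π d x ⊕_) (π-∑ d xs))

totalNorm-++ : ∀ {m} (xs ys : List (Zvec m)) → totalNorm (xs ++ ys) ≡ totalNorm xs + totalNorm ys
totalNorm-++ xs ys = trans (cong sum (Listₚ.map-++ norm1 xs ys)) (sumₚ.sum-++ (map norm1 xs) (map norm1 ys))

totalNorm-↭ : ∀ {m} {xs ys : List (Zvec m)} → xs ↭ ys → totalNorm xs ≡ totalNorm ys
totalNorm-↭ p = sumₚ.sum-↭ (↭ₚ.map⁺ norm1 p)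

≍ᵛ-∑ : ∀ {m} {u : Zvec m} {xs} → All (u ≍ᵛ_) xs → u ≍ᵛ ∑ xs
≍ᵛ-∑ {u = u} []  = ≍ᵛ-0v u
≍ᵛ-∑ (u≍x ∷ u≍xs) = ≍ᵛ-⊕ u≍x (≍ᵛ-∑ u≍xs)

totalNorm-≼ᵛ : ∀ {m} {s : Zvec m} {xs} → All (_≼ᵛ s) xs → totalNorm xs ≡ norm1 (∑ xs)
totalNorm-≼ᵛ {m} []                     = sym (norm1-0v {m})
totalNorm-≼ᵛ {xs = x ∷ xs} (x≼s ∷ xs≼s) = trans
  (cong (_+_ (norm1 x)) (totalNorm-≼ᵛ xs≼s))
  (sym (norm1-⊕-≍ᵛ (≍ᵛ-∑ (All.map (≼ᵛ-upperBound⇒≍ᵛ x≼s) xs≼s))))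

pair-≼ᵛ-∑ : ∀ {m} {s u v : Zvec m} {xs} → All (_≼ᵛ s) (u ∷ v ∷ xs) → u ⊕ v ≼ᵛ ∑ (u ∷ v ∷ xs)
pair-≼ᵛ-∑ {s = s} {u} {v} {xs} (u≼s ∷ v≼s ∷ xs≼s) =
  subst (u ⊕ v ≼ᵛ_) (⊕-assoc u v (∑ xs)) (≍ᵛ⇒u≼ᵛu⊕v (≍ᵛ-∑ (All.map u⊕v≍ᵛ xs≼s)))
  where
  u⊕v≍ᵛ : ∀ {x} → x ≼ᵛ s → u ⊕ v ≍ᵛ x
  u⊕v≍ᵛ x≼s = ≍ᵛ-sym (≍ᵛ-⊕ (≼ᵛ-upperBound⇒≍ᵛ x≼s u≼s) (≼ᵛ-upperBound⇒≍ᵛ x≼s v≼s))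

∈⇒↭∷ : ∀ {A : Set} {x : A} {xs} → x ∈ xs → ∃ λ ys → xs ↭ x ∷ ys
∈⇒↭∷ x∈xs with ys , zs , refl ← ∈-∃++ x∈xs = ys ++ zs , ↭ₚ.shift _ ys zs

incompatiblePair : ∀ {m} (xs : List (Zvec m)) → ¬ All (_≼ᵛ ∑ xs) xs →
                   ∃₂ λ u v → ∃ λ ys → xs ↭ u ∷ v ∷ ys × ¬ u ≍ᵛ v
incompatiblePair xs xs⋠∑
  with u , u∈xs , u⋠∑ ← find (Allₚ.¬All⇒Any¬ (_≼ᵛ? ∑ xs) xs xs⋠∑)
  with ys , xs↭u∷ys ← ∈⇒↭∷ u∈xs
  with all? (u ≍ᵛ?_) ys
... | yes u≍ys = contradiction (subst (u ≼ᵛ_) (sym (∑-↭ xs↭u∷ys)) (≍ᵛ⇒u≼ᵛu⊕v (≍ᵛ-∑ u≍ys))) u⋠∑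
... | no u≭ys
  with v , v∈ys , u≭v ← find (Allₚ.¬All⇒Any¬ (u ≍ᵛ?_) ys u≭ys)
  with zs , ys↭v∷zs ← ∈⇒↭∷ v∈ys
  = u , v , zs , ↭.trans xs↭u∷ys (↭.prep u ys↭v∷zs) , u≭v

∈-++∷⁻ : ∀ {A : Set} {x s : A} C₁ {C₂} → x ∈ C₁ ++ s ∷ C₂ → x ≡ s ⊎ x ∈ C₁ ++ C₂
∈-++∷⁻ C₁ x∈C with ↭ₚ.∈-resp-↭ (↭ₚ.shift _ C₁ _) x∈C
... | here x≡s        = inj₁ x≡s
... | there x∈C₁++C₂ = inj₂ x∈C₁++C₂

∈-++∷⁺ : ∀ {A : Set} {x s : A} C₁ {C₂} → x ∈ C₁ ++ C₂ → x ∈ C₁ ++ s ∷ C₂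
∈-++∷⁺ C₁ x∈C₁++C₂ = ↭ₚ.∈-resp-↭ (↭.↭-sym (↭ₚ.shift _ C₁ _)) (there x∈C₁++C₂)

-- Minimal elements and Dickson's lemma

open RawMonad (¬¬-Monad {a = 0ℓ}) using (pure; _>>=_)

minimalBelow : ∀ {m} (P : Zvec m → Set) {w} → Acc _<_ (norm1 w) → P w → w ≢ 0v →
               ¬ ¬ (∃ λ w′ → MinimalNonzero P w′ × w′ ≼ᵛ w)
minimalBelow P {w} (acc smaller) Pw w≢0 = do
  no ∄h ← ¬¬-excluded-middle {A = ∃ λ h → P h × h ≢ 0v × h ≼ᵛ w × h ≢ w}
    where yes (h , Ph , h≢0 , h≼w , h≢w) → do
            (w′ , w′-minimal , w′≼h) ← minimalBelow P (smaller (norm1-strictMono-≼ᵛ h≼w h≢w)) Ph h≢0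
            pure (w′ , w′-minimal , ≼ᵛ-trans w′≼h h≼w)
  pure (w , (Pw , w≢0 , λ h Ph h≢0 h⊑w →
    decidable-stable (h ≟ᵛ w) (λ h≢w → ∄h (h , Ph , h≢0 , ⊑⇒≼ᵛ h⊑w , h≢w))) , ≼ᵛ-refl)

Infinite : (ℕ → Set) → Set
Infinite S = ∀ n → ¬ ¬ (∃ λ i → n ≤ i × S i)

dickson : ∀ {m} (a : ℕ → Vec ℕ m) {S : ℕ → Set} → Infinite S →
          ¬ ¬ (∃₂ λ i j → i < j × S i × S j × Pointwise _≤_ (a i) (a j))
dickson {zero} a S-infinite = do
  (i , _ , Si) ← S-infinite 0
  (j , i<j , Sj) ← S-infinite (suc i)
  pure (i , j , i<j , Si , Sj , empty (a i) (a j))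
  where
  empty : (u v : Vec ℕ 0) → Pointwise _≤_ u v
  empty [] [] = []
dickson {suc m} a {S} S-infinite = do
  (i , j , i<j , (Si , headᵢ-least) , (Sj , _) , tailᵢ≤tailⱼ) ← dickson (Vec.tail ∘ a) headMinimal-infinite
  pure (i , j , i<j , Si , Sj , cons (a i) (a j) (headᵢ-least j i<j Sj) tailᵢ≤tailⱼ)
  where
  head : ℕ → ℕ
  head = Vec.head ∘ a

  HeadMinimal : ℕ → Set
  HeadMinimal i = S i × (∀ j → i < j → S j → head i ≤ head j)

  cons : (u v : Vec ℕ (suc m)) → Vec.head u ≤ Vec.head v →
         Pointwise _≤_ (Vec.tail u) (Vec.tail v) → Pointwise _≤_ u v
  cons (_ ∷ _) (_ ∷ _) x≤y u≤v = x≤y ∷ u≤v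

  headMinimal-from : ∀ n i → n ≤ i → S i → Acc _<_ (head i) → ¬ ¬ (∃ λ i′ → n ≤ i′ × HeadMinimal i′)
  headMinimal-from n i n≤i Si (acc smaller) = do
    no ∄j ← ¬¬-excluded-middle {A = ∃ λ j → n ≤ j × S j × head j < head i}
      where yes (j , n≤j , Sj , headⱼ<headᵢ) → headMinimal-from n j n≤j Sj (smaller headⱼ<headᵢ)
    pure (i , n≤i , Si , λ j i<j Sj →
      ℕₚ.≮⇒≥ (λ headⱼ<headᵢ → ∄j (j , ℕₚ.≤-trans n≤i (ℕₚ.<⇒≤ i<j) , Sj , headⱼ<headᵢ)))

  headMinimal-infinite : Infinite HeadMinimal
  headMinimal-infinite n = do
    (i , n≤i , Si) ← S-infinite n
    headMinimal-from n i n≤i Si (ℕᵢ.<-wellFounded (head i))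

positivePart negativePart : ℤ → ℕ
positivePart (+ n)    = n
positivePart -[1+ _ ] = 0
negativePart (+ _)    = 0
negativePart -[1+ n ] = suc n

parts≤⇒≼ : ∀ x y → positivePart x ≤ positivePart y → negativePart x ≤ negativePart y → x ≼ y
parts≤⇒≼ (+ _)    (+ _)    m≤n _   = +≍+ , m≤n
parts≤⇒≼ (+ _)    -[1+ _ ] z≤n _   = 0≍- , z≤n
parts≤⇒≼ -[1+ _ ] (+ _)    _   ()
parts≤⇒≼ -[1+ _ ] -[1+ _ ] _   m≤n = -≍- , m≤n

encode : ∀ {m} → Zvec m → Vec ℕ (m + m)
encode u = Vec.map positivePart u Vec.++ Vec.map negativePart u

encode-≤⇒≼ᵛ : ∀ {m} (u v : Zvec m) → Pointwise _≤_ (encode u) (encode v) → u ≼ᵛ v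
encode-≤⇒≼ᵛ u v enc≤ =
  parts≤⇒≼ᵛ u v (Pw.++ˡ⁻ (Vec.map positivePart u) (Vec.map positivePart v) enc≤)
                (Pw.++ʳ⁻ (Vec.map positivePart u) (Vec.map positivePart v) enc≤)
  where
  parts≤⇒≼ᵛ : ∀ {m} (u v : Zvec m) →
              Pointwise _≤_ (Vec.map positivePart u) (Vec.map positivePart v) →
              Pointwise _≤_ (Vec.map negativePart u) (Vec.map negativePart v) → u ≼ᵛ v
  parts≤⇒≼ᵛ []      []      []         []         = []
  parts≤⇒≼ᵛ (x ∷ u) (y ∷ v) (x⁺≤y⁺ ∷ u⁺≤v⁺) (x⁻≤y⁻ ∷ u⁻≤v⁻) =
    parts≤⇒≼ x y x⁺≤y⁺ x⁻≤y⁻ ∷ parts≤⇒≼ᵛ u v u⁺≤v⁺ u⁻≤v⁻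

-- Completeness of a closed generating set

Reducible : ∀ {m} → List (Zvec m) → Zvec m → Set
Reducible G s = (∃ λ h → h ∈ G × h ⊑ s) ⊎ s ≡ 0v

module Completion {d k} (B : Vec (Zvec (d + k)) d)
  (π-injective : ∀ u v → InLattice B u → InLattice B v → π d u ≡ π d v → u ≡ v)
  (G : List (Zvec (d + k)))
  (G-valid : ∀ {g} → g ∈ G → InLattice B g × g ≢ 0v)
  (G-covers : ∀ {v} → InLattice B v → v ≢ 0v → ¬ ¬ (∃ λ f → f ∈ G × π d f ≼ᵛ π d v))
  (G-closed : ∀ {x y} → x ∈ G → y ∈ G → SameOrthant (π d x) (π d y) → Reducible G (x ⊕ y))
  where

  private
    V : Set
    V = Zvec (d + k)

    Λ : V → Set
    Λ = InLattice B

    ‖_‖ : V → ℕ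
    ‖ v ‖ = norm d v

  IsDecomposition : V → List V → Set
  IsDecomposition v L = All (_∈ G) L × ∑ L ≡ v × All (_≼ᵛ v) L

  IsProjDecomposition : V → List V → Set
  IsProjDecomposition v L = All (_∈ G) L × ∑ L ≡ v × All (λ x → π d x ≼ᵛ π d v) L

  Decomposition : V → Set
  Decomposition v = ∃ (IsDecomposition v)

  Decomposable< : ℕ → Set
  Decomposable< n = ∀ {w} → ‖ w ‖ < n → Λ w → ¬ ¬ Decomposition w

  ‖v⊖g‖<‖v‖ : ∀ {g v} → g ∈ G → π d g ≼ᵛ π d v → ‖ v ⊖ g ‖ < ‖ v ‖
  ‖v⊖g‖<‖v‖ {g} {v} g∈G πg≼πv = begin-strict
    ‖ v ⊖ g ‖              <⟨ ℕₚ.m<n+m _ (u≢0v⇒norm1>0 (π-nonzero π-injective g∈Λ g≢0)) ⟩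
    ‖ g ‖ + ‖ v ⊖ g ‖      ≡⟨ cong (_+_ ‖ g ‖ ∘ norm1) (π-⊖ d v g) ⟩
    ‖ g ‖ + norm1 (π d v ⊖ π d g) ≡⟨ norm1-⊖ πg≼πv ⟩
    ‖ v ‖                  ∎
    where
    open ℕₚ.≤-Reasoning
    g∈Λ = proj₁ (G-valid g∈G)
    g≢0 = proj₂ (G-valid g∈G)

  pairDecomposition : ∀ {a b} → a ∈ G → b ∈ G → π d a ≍ᵛ π d b →
                      Decomposable< ‖ a ⊕ b ‖ → ¬ ¬ Decomposition (a ⊕ b)
  pairDecomposition {a} {b} a∈G b∈G πa≍πb decomposable
    with G-closed a∈G b∈G (≍ᵛ⇒SameOrthant πa≍πb)
  ... | inj₂ a⊕b≡0 = pure ([] , [] , sym a⊕b≡0 , [])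
  ... | inj₁ (h , h∈G , h⊑a⊕b) = do
    (M , M⊆G , ∑M≡r , M≼r) ← decomposable (‖v⊖g‖<‖v‖ h∈G (π-Pointwise d h≼a⊕b)) r∈Λ
    pure (h ∷ M , h∈G ∷ M⊆G , trans (cong (h ⊕_) ∑M≡r) (u⊕[v⊖u]≡v h (a ⊕ b)) ,
          h≼a⊕b ∷ All.map (λ m≼r → ≼ᵛ-trans m≼r (v⊖u≼ᵛv h≼a⊕b)) M≼r)
    where
    h≼a⊕b = ⊑⇒≼ᵛ h⊑a⊕b
    r∈Λ = InLattice-⊖ B (InLattice-⊕ B (proj₁ (G-valid a∈G)) (proj₁ (G-valid b∈G))) (proj₁ (G-valid h∈G))

  IsProjDecomposition-↭ : ∀ {v L L′} → L ↭ L′ → IsProjDecomposition v L → IsProjDecomposition v L′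
  IsProjDecomposition-↭ L↭L′ (L⊆G , ∑L≡v , πL≼πv) =
    ↭ₚ.All-resp-↭ L↭L′ L⊆G , trans (sym (∑-↭ L↭L′)) ∑L≡v , ↭ₚ.All-resp-↭ L↭L′ πL≼πv

  replacePair : ∀ {v a b R} → Decomposable< ‖ v ‖ → ¬ a ≍ᵛ b → IsProjDecomposition v (a ∷ b ∷ R) →
                ¬ ¬ (∃ λ L → IsProjDecomposition v L × totalNorm L < totalNorm (a ∷ b ∷ R))
  replacePair {v} {a} {b} {R} decomposable a≭b (a∈G ∷ b∈G ∷ R⊆G , ∑≡v , πa≼πv ∷ πb≼πv ∷ πR≼πv) = do
    (P , P⊆G , ∑P≡a⊕b , P≼a⊕b) ←
      pairDecomposition a∈G b∈G (≼ᵛ-upperBound⇒≍ᵛ πa≼πv πb≼πv)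
                        (λ ‖w‖<‖a⊕b‖ → decomposable (ℕₚ.<-≤-trans ‖w‖<‖a⊕b‖ (norm1-mono-≼ᵛ πa⊕b≼πv)))
    pure (P ++ R ,
          (Allₚ.++⁺ P⊆G R⊆G , sum-preserved {P} ∑P≡a⊕b , Allₚ.++⁺ (All.map π-below P≼a⊕b) πR≼πv) ,
          lighter P≼a⊕b ∑P≡a⊕b)
    where
    πa⊕b≼πv : π d (a ⊕ b) ≼ᵛ π d v
    πa⊕b≼πv = subst₂ _≼ᵛ_ (sym (π-⊕ d a b)) (trans (sym (π-∑ d (a ∷ b ∷ R))) (cong (π d) ∑≡v))
                (pair-≼ᵛ-∑ (πa≼πv ∷ πb≼πv ∷ Allₚ.map⁺ πR≼πv))

    π-below : ∀ {x} → x ≼ᵛ a ⊕ b → π d x ≼ᵛ π d v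
    π-below x≼a⊕b = ≼ᵛ-trans (π-Pointwise d x≼a⊕b) πa⊕b≼πv

    sum-preserved : ∀ {P} → ∑ P ≡ a ⊕ b → ∑ (P ++ R) ≡ v
    sum-preserved {P} ∑P≡a⊕b = begin
      ∑ (P ++ R)     ≡⟨ ∑-++ P R ⟩
      ∑ P ⊕ ∑ R      ≡⟨ cong (_⊕ ∑ R) ∑P≡a⊕b ⟩
      (a ⊕ b) ⊕ ∑ R  ≡⟨ ⊕-assoc a b (∑ R) ⟩
      ∑ (a ∷ b ∷ R)  ≡⟨ ∑≡v ⟩
      v              ∎
      where open ≡-Reasoning

    lighter : ∀ {P} → All (_≼ᵛ a ⊕ b) P → ∑ P ≡ a ⊕ b → totalNorm (P ++ R) < totalNorm (a ∷ b ∷ R)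
    lighter {P} P≼a⊕b ∑P≡a⊕b = begin-strict
      totalNorm (P ++ R)                  ≡⟨ totalNorm-++ P R ⟩
      totalNorm P + totalNorm R           ≡⟨ cong (_+ totalNorm R) totalNorm-P ⟩
      norm1 (a ⊕ b) + totalNorm R         <⟨ ℕₚ.+-monoˡ-< (totalNorm R) (norm1-⊕-≭ᵛ a b a≭b) ⟩
      (norm1 a + norm1 b) + totalNorm R   ≡⟨ ℕₚ.+-assoc (norm1 a) (norm1 b) (totalNorm R) ⟩
      totalNorm (a ∷ b ∷ R)               ∎
      where
      open ℕₚ.≤-Reasoning
      totalNorm-P = trans (totalNorm-≼ᵛ P≼a⊕b) (cong norm1 ∑P≡a⊕b)

  descend : ∀ {v} → Decomposable< ‖ v ‖ → ∀ L → Acc _<_ (totalNorm L) → IsProjDecomposition v L →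
            ¬ ¬ Decomposition v
  descend {v} decomposable L (acc lighter) L-proj@(L⊆G , ∑L≡v , _) with all? (_≼ᵛ? v) L
  ... | yes L≼v = pure (L , L⊆G , ∑L≡v , L≼v)
  ... | no L⋠v = do
    let (a , b , R , L↭a∷b∷R , a≭b) = incompatiblePair L (subst (λ s → ¬ All (_≼ᵛ s) L) (sym ∑L≡v) L⋠v)
    (L′ , L′-proj , L′<a∷b∷R) ← replacePair decomposable a≭b (IsProjDecomposition-↭ L↭a∷b∷R L-proj)
    descend decomposable L′ (lighter (subst (totalNorm L′ <_) (sym (totalNorm-↭ L↭a∷b∷R)) L′<a∷b∷R)) L′-proj

  decompose : ∀ {v} → Acc _<_ ‖ v ‖ → Λ v → ¬ ¬ Decomposition v
  decompose {v} (acc smaller) v∈Λ with v ≟ᵛ 0v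
  ... | yes refl = pure ([] , [] , refl , [])
  ... | no v≢0 = do
    (f , f∈G , πf≼πv) ← G-covers v∈Λ v≢0
    (M , M⊆G , ∑M≡v⊖f , M≼v⊖f) ←
      decompose (smaller (‖v⊖g‖<‖v‖ f∈G πf≼πv)) (InLattice-⊖ B v∈Λ (proj₁ (G-valid f∈G)))
    descend (decompose ∘ smaller) (f ∷ M) (ℕᵢ.<-wellFounded _)
      (f∈G ∷ M⊆G , trans (cong (f ⊕_) ∑M≡v⊖f) (u⊕[v⊖u]≡v f v) ,
       πf≼πv ∷ All.map (λ m≼v⊖f → ≼ᵛ-trans (π-Pointwise d m≼v⊖f) (πv⊖πf≼πv πf≼πv)) M≼v⊖f)
    where
    πv⊖πf≼πv : ∀ {f} → π d f ≼ᵛ π d v → π d (v ⊖ f) ≼ᵛ π d v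
    πv⊖πf≼πv {f} πf≼πv = subst (_≼ᵛ π d v) (sym (π-⊖ d v f)) (v⊖u≼ᵛv πf≼πv)

  graver⊆G : ∀ {g} → InGraver B g → g ∈ G
  graver⊆G {g} (g∈Λ , g≢0 , g-minimal) = decidable-stable (DecMem._∈?_ _≟ᵛ_ g G) (do
    (L , L-decomposes) ← decompose (ℕᵢ.<-wellFounded _) g∈Λ
    pure (summand∈G L L-decomposes))
    where
    summand∈G : ∀ L → IsDecomposition g L → g ∈ G
    summand∈G []      (_ , ∑[]≡g , _) = contradiction (sym ∑[]≡g) g≢0
    summand∈G (h ∷ _) (h∈G ∷ _ , _ , h≼g ∷ _) =
      subst (_∈ G) (g-minimal h (proj₁ (G-valid h∈G)) (proj₂ (G-valid h∈G)) (≼ᵛ⇒⊑ h≼g)) h∈G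

-- The invariant of the algorithm

NF-zero : ∀ {m} {s f : Zvec m} {G} → NF s G f → f ≡ 0v → Reducible G s
NF-zero (inj₁ (reducible , _)) _   = inj₁ (find reducible)
NF-zero (inj₂ (_ , f≡s))       f≡0 = inj₂ (trans (sym f≡s) f≡0)

NF-nonzero : ∀ {m} {s f : Zvec m} {G} → NF s G f → f ≢ 0v → f ≡ s × ¬ Any (_⊑ s) G
NF-nonzero (inj₁ (_ , f≡0))          f≢0 = contradiction f≡0 f≢0
NF-nonzero (inj₂ (irreducible , f≡s)) _  = f≡s , irreducible

Reducible-++ : ∀ {m} {G : List (Zvec m)} {s} H → Reducible G s → Reducible (G ++ H) s
Reducible-++ H (inj₁ (h , h∈G , h⊑s)) = inj₁ (h , ∈-++⁺ˡ h∈G , h⊑s)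
Reducible-++ H (inj₂ s≡0)            = inj₂ s≡0

module Algorithm {d k} (B : Vec (Zvec (d + k)) d) (F̄ : List (Zvec (d + k)))
  (F̄-valid : ∀ {f} → f ∈ F̄ → InLattice B f × f ≢ 0v)
  where

  private
    V : Set
    V = Zvec (d + k)

  record Invariant (G C : List V) : Set where
    field
      F̄⊆G           : ∀ {f} → f ∈ F̄ → f ∈ G
      G-valid       : ∀ {g} → g ∈ G → InLattice B g × g ≢ 0v
      C⊆Λ           : ∀ {c} → c ∈ C → InLattice B c
      pairs-covered : ∀ {x y} → x ∈ G → y ∈ G → SameOrthant (π d x) (π d y) →
                      x ⊕ y ∈ C ⊎ Reducible G (x ⊕ y)

  ∈-newPairs⁺ : ∀ {f y : V} {G} → y ∈ G → SameOrthant (π d f) (π d y) → f ⊕ y ∈ newPairs d f G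
  ∈-newPairs⁺ {f} y∈G πf∥πy = ∈-map⁺ (f ⊕_) (∈-filter⁺ (λ g → sameOrthant? (π d f) (π d g)) y∈G πf∥πy)

  ∈-newPairs⁻ : ∀ {f c : V} {G} → c ∈ newPairs d f G → ∃ λ y → y ∈ G × c ≡ f ⊕ y
  ∈-newPairs⁻ {f} c∈ with y , y∈filtered , c≡f⊕y ← ∈-map⁻ (f ⊕_) c∈ =
    y , proj₁ (∈-filter⁻ (λ g → sameOrthant? (π d f) (π d g)) y∈filtered) , c≡f⊕y

  initial : Invariant F̄ (initPairs d F̄)
  initial = record
    { F̄⊆G           = λ f∈F̄ → f∈F̄
    ; G-valid       = F̄-valid
    ; C⊆Λ           = C⊆Λ
    ; pairs-covered = λ x∈F̄ y∈F̄ πx∥πy →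
        inj₁ (∈-concatMap⁺ (λ f → newPairs d f F̄) (lose x∈F̄ (∈-newPairs⁺ y∈F̄ πx∥πy)))
    }
    where
    C⊆Λ : ∀ {c} → c ∈ initPairs d F̄ → InLattice B c
    C⊆Λ c∈
      with x , x∈F̄ , c∈newPairs ← find (∈-concatMap⁻ (λ f → newPairs d f F̄) {xs = F̄} c∈)
      with y , y∈F̄ , c≡x⊕y ← ∈-newPairs⁻ c∈newPairs
      = subst (InLattice B) (sym c≡x⊕y) (InLattice-⊕ B (proj₁ (F̄-valid x∈F̄)) (proj₁ (F̄-valid y∈F̄)))

  discharge : ∀ {G : List V} {s c : V} C₁ {C₂} → Reducible G s →
              c ∈ C₁ ++ s ∷ C₂ ⊎ Reducible G c → c ∈ C₁ ++ C₂ ⊎ Reducible G c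
  discharge C₁ _ (inj₂ c-reducible) = inj₂ c-reducible
  discharge C₁ s-reducible (inj₁ c∈C) with ∈-++∷⁻ C₁ c∈C
  ... | inj₁ refl        = inj₂ s-reducible
  ... | inj₂ c∈C₁++C₂  = inj₁ c∈C₁++C₂

  step-preserves : ∀ {G C G′ C′} → Step d k (G , C) (G′ , C′) → Invariant G C → Invariant G′ C′
  step-preserves (stepZero {C₁ = C₁} _ nf f≡0) inv = record
    { F̄⊆G           = F̄⊆G
    ; G-valid       = G-valid
    ; C⊆Λ           = C⊆Λ ∘ ∈-++∷⁺ C₁
    ; pairs-covered = λ x∈G y∈G πx∥πy → discharge C₁ (NF-zero nf f≡0) (pairs-covered x∈G y∈G πx∥πy)
    }
    where open Invariant inv
  step-preserves (stepAdd {G} {C₁} {C₂} {s} _ nf f≢0) inv with NF-nonzero nf f≢0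
  ... | refl , _ = record
    { F̄⊆G           = ∈-++⁺ˡ ∘ F̄⊆G
    ; G-valid       = G′-valid
    ; C⊆Λ           = C′⊆Λ
    ; pairs-covered = covered
    }
    where
    open Invariant inv
    G′ = G ++ [ s ]
    C′ = (C₁ ++ C₂) ++ newPairs d s G′

    s∈Λ : InLattice B s
    s∈Λ = C⊆Λ (∈-++⁺ʳ C₁ (here refl))

    G′-valid : ∀ {g} → g ∈ G′ → InLattice B g × g ≢ 0v
    G′-valid g∈G′ with ∈-++⁻ G g∈G′
    ... | inj₁ g∈G         = G-valid g∈G
    ... | inj₂ (here refl) = s∈Λ , f≢0

    C′⊆Λ : ∀ {c} → c ∈ C′ → InLattice B c
    C′⊆Λ c∈C′ with ∈-++⁻ (C₁ ++ C₂) c∈C′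
    ... | inj₁ c∈C₁++C₂ = C⊆Λ (∈-++∷⁺ C₁ c∈C₁++C₂)
    ... | inj₂ c∈new with y , y∈G′ , refl ← ∈-newPairs⁻ c∈new = InLattice-⊕ B s∈Λ (proj₁ (G′-valid y∈G′))

    covered : ∀ {x y} → x ∈ G′ → y ∈ G′ → SameOrthant (π d x) (π d y) → x ⊕ y ∈ C′ ⊎ Reducible G′ (x ⊕ y)
    covered {x} x∈G′ y∈G′ πx∥πy with ∈-++⁻ G x∈G′ | ∈-++⁻ G y∈G′
    ... | inj₂ (here refl) | _ = inj₁ (∈-++⁺ʳ (C₁ ++ C₂) (∈-newPairs⁺ y∈G′ πx∥πy))
    ... | inj₁ _ | inj₂ (here refl) = inj₁ (subst (_∈ C′) (⊕-comm s x)
            (∈-++⁺ʳ (C₁ ++ C₂) (∈-newPairs⁺ x∈G′ (SameOrthant-sym πx∥πy))))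
    ... | inj₁ x∈G | inj₁ y∈G = Sum.map₁ ∈-++⁺ˡ
            (discharge C₁ (inj₁ (s , ∈-++⁺ʳ G (here refl) , ≼ᵛ⇒⊑ (≼ᵛ-refl {u = s})))
                          (Sum.map₂ (Reducible-++ [ s ]) (pairs-covered x∈G y∈G πx∥πy)))

  reachable : ∀ {G C G′ C′} → Reachable d k (G , C) (G′ , C′) → Invariant G C → Invariant G′ C′
  reachable ε              inv = inv
  reachable (step ◅ steps) inv = reachable steps (step-preserves step inv)

-- Termination

module Termination (d k : ℕ) where

  private
    V : Set
    V = Zvec (d + k)

  IsAdd : ∀ {σ σ′} → Step d k σ σ′ → Set
  IsAdd (stepZero _ _ _) = ⊥
  IsAdd (stepAdd _ _ _)  = ⊤

  chosen : ∀ {σ σ′} → Step d k σ σ′ → V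
  chosen (stepZero {s = s} _ _ _) = s
  chosen (stepAdd {s = s} _ _ _)  = s

  step-⊆ : ∀ {σ σ′ x} → Step d k σ σ′ → x ∈ proj₁ σ → x ∈ proj₁ σ′
  step-⊆ (stepZero _ _ _) x∈G = x∈G
  step-⊆ (stepAdd _ _ _)  x∈G = ∈-++⁺ˡ x∈G

  zeroStep-shrinks : ∀ {σ σ′} (step : Step d k σ σ′) → ¬ IsAdd step →
                     List.length (proj₂ σ′) < List.length (proj₂ σ)
  zeroStep-shrinks (stepZero {C₁ = C₁} {C₂} {s} _ _ _) _ =
    ℕₚ.≤-reflexive (sym (↭ₚ.↭-length (↭ₚ.shift s C₁ C₂)))
  zeroStep-shrinks (stepAdd _ _ _) ¬add = contradiction tt ¬add

  addStep-chosen : ∀ {σ σ′} (step : Step d k σ σ′) → IsAdd step →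
                   chosen step ∈ proj₁ σ′ × ¬ Any (_⊑ chosen step) (proj₁ σ)
  addStep-chosen (stepAdd {G} _ nf f≢0) _ with NF-nonzero nf f≢0
  ... | refl , irreducible = ∈-++⁺ʳ G (here refl) , irreducible

  noInfiniteRun : (r : ℕ → State (d + k)) → ¬ (∀ i → Step d k (r i) (r (suc i)))
  noInfiniteRun r step = dickson (encode ∘ chosen ∘ step) adds-infinite
    λ (i , j , i<j , addᵢ , addⱼ , encᵢ≤encⱼ) →
      proj₂ (addStep-chosen (step j) addⱼ)
        (lose (⊆-later (ℕₚ.≤⇒≤′ i<j) (proj₁ (addStep-chosen (step i) addᵢ)))
              (≼ᵛ⇒⊑ (encode-≤⇒≼ᵛ (chosen (step i)) (chosen (step j)) encᵢ≤encⱼ)))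
    where
    G : ℕ → List V
    G i = proj₁ (r i)

    ⊆-later : ∀ {i j x} → i ℕ.≤′ j → x ∈ G i → x ∈ G j
    ⊆-later ℕ.≤′-refl        x∈Gᵢ = x∈Gᵢ
    ⊆-later (ℕ.≤′-step i≤′j) x∈Gᵢ = step-⊆ (step _) (⊆-later i≤′j x∈Gᵢ)

    adds-infinite : Infinite (IsAdd ∘ step)
    adds-infinite n no-add-from-n = ℕₚ.<-irrefl refl (ℕₚ.m+n≤o⇒m≤o (suc (c n)) (countdown (suc (c n))))
      where
      c : ℕ → ℕ
      c i = List.length (proj₂ (r i))

      countdown : ∀ t → t + c (t + n) ≤ c n
      countdown zero    = ℕₚ.≤-refl
      countdown (suc t) = begin
        suc t + c (suc t + n)   ≡⟨ sym (ℕₚ.+-suc t _) ⟩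
        t + suc (c (suc t + n)) ≤⟨ ℕₚ.+-monoʳ-≤ t (zeroStep-shrinks (step (t + n)) no-add-at-t+n) ⟩
        t + c (t + n)           ≤⟨ countdown t ⟩
        c n                     ∎
        where
        open ℕₚ.≤-Reasoning
        no-add-at-t+n = λ add → no-add-from-n (t + n , ℕₚ.m≤n+m n t , add)

module ProjectedGraver {d k} (B : Vec (Zvec (d + k)) d)
  (π-injective : ∀ u v → InLattice B u → InLattice B v → π d u ≡ π d v → u ≡ v)
  (F̄ : List (Zvec (d + k)))
  (F̄⊆Λ : ∀ f → f ∈ F̄ → InLattice B f)
  (F̄-projects : ∀ w → (w ∈ map (π d) F̄ → MinimalNonzero (InProjLattice B) w)
                    × (MinimalNonzero (InProjLattice B) w → w ∈ map (π d) F̄))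
  where

  F̄-valid : ∀ {f} → f ∈ F̄ → InLattice B f × f ≢ 0v
  F̄-valid {f} f∈F̄ = F̄⊆Λ f f∈F̄ , λ f≡0 →
    proj₁ (proj₂ (proj₁ (F̄-projects (π d f)) (∈-map⁺ (π d) f∈F̄))) (trans (cong (π d) f≡0) (π-0v d))

  F̄-covers : ∀ {v} → InLattice B v → v ≢ 0v → ¬ ¬ (∃ λ f → f ∈ F̄ × π d f ≼ᵛ π d v)
  F̄-covers {v} v∈Λ v≢0 = do
    (w , w-minimal , w≼πv) ←
      minimalBelow (InProjLattice B) (ℕᵢ.<-wellFounded _) (v , v∈Λ , refl) (π-nonzero π-injective v∈Λ v≢0)
    let (f , f∈F̄ , w≡πf) = ∈-map⁻ (π d) (proj₂ (F̄-projects w) w-minimal)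
    pure (f , f∈F̄ , subst (_≼ᵛ π d v) w≡πf w≼πv)

  open Algorithm B F̄ F̄-valid

  complete : ∀ {G} → Reachable d k (F̄ , initPairs d F̄) (G , []) → ∀ {g} → InGraver B g → g ∈ G
  complete {G} run = Completion.graver⊆G B π-injective G G-valid G-covers G-closed
    where
    open Invariant (reachable run initial)

    G-covers : ∀ {v} → InLattice B v → v ≢ 0v → ¬ ¬ (∃ λ f → f ∈ G × π d f ≼ᵛ π d v)
    G-covers v∈Λ v≢0 = do
      (f , f∈F̄ , πf≼πv) ← F̄-covers v∈Λ v≢0
      pure (f , F̄⊆G f∈F̄ , πf≼πv)

    G-closed : ∀ {x y} → x ∈ G → y ∈ G → SameOrthant (π d x) (π d y) → Reducible G (x ⊕ y)
    G-closed x∈G y∈G πx∥πy = Sum.fromInj₂ (λ ()) (pairs-covered x∈G y∈G πx∥πy)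

lemma11 : (d k : ℕ) (B : Vec (Zvec (d + k)) d)
    → (∀ u v → InLattice B u → InLattice B v → π d u ≡ π d v → u ≡ v)
    → (F̄ : List (Zvec (d + k)))
    → (∀ f → f ∈ F̄ → InLattice B f)
    → (∀ w → (w ∈ map (π d) F̄ → MinimalNonzero (InProjLattice B) w)
             × (MinimalNonzero (InProjLattice B) w → w ∈ map (π d) F̄))
    → ((r : ℕ → State (d + k)) → r 0 ≡ (F̄ , initPairs d F̄)
         → ¬ (∀ i → Step d k (r i) (r (suc i))))
      × (∀ G → Reachable d k (F̄ , initPairs d F̄) (G , [])
         → ∀ g → InGraver B g → g ∈ G)
lemma11 d k B π-injective F̄ F̄⊆Λ F̄-projects =
  (λ r _ → Termination.noInfiniteRun d k r) ,
  (λ G run g → ProjectedGraver.complete B π-injective F̄ F̄⊆Λ F̄-projects run)
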